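{- Let $q,n,k$ be integers with either $q>2$ and $n>k\ge 1$, or $q=2$ and $n>k\ge 2$. Then \[\frac{\genfrac{[}{]}{0pt}{0}{n}{k}_q^2}{\binom{q^n}{q^k}}<\frac{1}{q^{q^k-2k}}\cdot\frac{\genfrac{[}{]}{0pt}{0}{n-1}{k}_q^2}{\binom{q^{n-1}}{q^k}}.\]
   Context: $\genfrac{[}{]}{0pt}{0}{n}{k}_q=\prod_{i=0}^{k-1}\frac{q^{n-i}-1}{q^{k-i}-1}$ is the Gaussian binomial coefficient and $\binom{a}{b}$ the ordinary binomial coefficient. -}

module Defs where

open import Data.Nat as ℕ using (ℕ; zero; suc; _∸_; _^_)
open import Data.Nat.Combinatorics using (_C_)
open import Data.Integer using (+_)
open import Data.Rational using (ℚ; _/_; _*_; 0ℚ; 1ℚ)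

-- a / b as a rational number, for natural numbers a, b.
-- Convention: a / 0 := 0 (never used below with b = 0 under the hypotheses).
_÷ℕ_ : ℕ → ℕ → ℚ
a ÷ℕ zero    = 0ℚ
a ÷ℕ (suc b) = (+ a) / suc b

-- Gaussian binomial coefficient, exactly by the product formula
--   [n k]_q = ∏_{i=0}^{k-1} (q^{n-i} - 1) / (q^{k-i} - 1),
-- computed in ℚ.  Here the factor for i is (q^(n∸i) ∸ 1) ÷ (q^(k∸i) ∸ 1);
-- for i < k ≤ n and q ≥ 2 the truncated subtractions are exact.
gaussProd : ℕ → ℕ → ℕ → ℕ → ℚ
gaussProd q n k zero    = 1ℚ
gaussProd q n k (suc i) =
  gaussProd q n k i * ((q ^ (n ∸ i) ∸ 1) ÷ℕ (q ^ (k ∸ i) ∸ 1))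

gaussBinom : ℕ → ℕ → ℕ → ℚ
gaussBinom q n k = gaussProd q n k k

module Submission where

-- Write N = q^n, M = q^(n-1), K = q^k. Since [n k]_q (q^(n-k) - 1) = [n-1 k]_q (q^n - 1), the
-- claim is equivalent to (q^n - 1)² q^(K-2k) C(M,K) < (q^(n-k) - 1)² C(N,K). Multiplying by K²·K!
-- and using q^K·M(M-1)⋯(M-K+1) = N(N-q)⋯(N-q(K-1)) and N - K = K(q^(n-k) - 1), it becomes
--   (N-1)² ∏_{j<K} (N - qj) < (N-K)² ∏_{j<K} (N - j).
-- The same inequality with J factors in place of K propagates from J to J+1, because
-- (N - qJ)(N - J) ≤ (N - J - 1)² as soon as qJ ≥ J + 2. It starts at J = 2 when q ≥ 3, since
-- (N-1)(N-q) < (N-2)², but for q = 2 it fails at J = 2 and J = 3 and only holds from J = 4 on: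
-- this is why k ≥ 2 is needed when q = 2.

open import Defs

module _ where

  open import Data.Nat
  open import Data.Nat.Properties
  open import Data.Nat.Combinatorics using (_C_; _P_; nCk≡nPk/k!)
  open import Data.Nat.Combinatorics.Base using (_P′_)
  open import Data.Nat.Combinatorics.Specification using (k!∣nP′k)
  open import Data.Nat.DivMod using (m/n*n≡m)
  open import Data.Nat.Tactic.RingSolver using (solve-∀)
  open import Data.Bool using (true)
  open import Data.Product using (_×_; _,_)
  open import Data.Sum using (_⊎_; inj₁; inj₂)
  open import Relation.Binary.PropositionalEquality

  strided : ℕ → ℕ → ℕ → ℕ
  strided N s zero    = 1
  strided N s (suc j) = (N ∸ s * j) * strided N s j

  StridedBound : ℕ → ℕ → ℕ → Set
  StridedBound N q j = (N ∸ 1) * (N ∸ 1) * strided N q j < (N ∸ j) * (N ∸ j) * (N P′ j)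

  [x∸2]*x≤[x∸1]² : ∀ x → (x ∸ 2) * x ≤ (x ∸ 1) * (x ∸ 1)
  [x∸2]*x≤[x∸1]² zero          = z≤n
  [x∸2]*x≤[x∸1]² (suc zero)    = z≤n
  [x∸2]*x≤[x∸1]² (suc (suc y)) = ≤-trans (m≤m+n (y * (2 + y)) 1) (≤-reflexive (expand y))
    where
    expand : ∀ y → y * (2 + y) + 1 ≡ (1 + y) * (1 + y)
    expand = solve-∀

  [N∸q*j]*[N∸j]≤[N∸1+j]² : ∀ N q j → 2 ≤ q → 2 ≤ j →
                            (N ∸ q * j) * (N ∸ j) ≤ (N ∸ suc j) * (N ∸ suc j)
  [N∸q*j]*[N∸j]≤[N∸1+j]² N q j q≥2 j≥2 = begin
    (N ∸ q * j) * (N ∸ j)       ≤⟨ *-monoˡ-≤ (N ∸ j) (∸-monoʳ-≤ N 2+j≤q*j) ⟩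
    (N ∸ (j + 2)) * (N ∸ j)     ≡⟨ cong (_* (N ∸ j)) (∸-+-assoc N j 2) ⟨
    (N ∸ j ∸ 2) * (N ∸ j)       ≤⟨ [x∸2]*x≤[x∸1]² (N ∸ j) ⟩
    (N ∸ j ∸ 1) * (N ∸ j ∸ 1)   ≡⟨ cong (λ x → x * x) (∸-+-assoc N j 1) ⟩
    (N ∸ (j + 1)) * (N ∸ (j + 1)) ≡⟨ cong (λ x → (N ∸ x) * (N ∸ x)) (+-comm j 1) ⟩
    (N ∸ suc j) * (N ∸ suc j)   ∎
    where
    open ≤-Reasoning
    2+j≤q*j : j + 2 ≤ q * j
    2+j≤q*j = begin
      j + 2     ≤⟨ +-monoʳ-≤ j j≥2 ⟩
      j + j     ≡⟨ cong (j +_) (+-identityʳ j) ⟨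
      2 * j     ≤⟨ *-monoˡ-≤ j q≥2 ⟩
      q * j     ∎

  stridedBound-suc : ∀ {N q j} → 2 ≤ q → 2 ≤ j → q * j < N →
                     StridedBound N q j → StridedBound N q (suc j)
  stridedBound-suc {N} {q} {j} q≥2 j≥2 qj<N bound = begin-strict
    a * a * (c * F)           ≡⟨ rearrangeˡ a c F ⟩
    c * (a * a * F)           <⟨ *-monoʳ-< c {{>-nonZero (m<n⇒0<n∸m qj<N)}} bound ⟩
    c * (d * d * P)           ≡⟨ rearrangeʳ c d P ⟩
    (c * d) * (d * P)         ≤⟨ *-monoˡ-≤ (d * P) ([N∸q*j]*[N∸j]≤[N∸1+j]² N q j q≥2 j≥2) ⟩
    (N ∸ suc j) * (N ∸ suc j) * (d * P) ∎
    where
    open ≤-Reasoning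
    a = N ∸ 1
    c = N ∸ q * j
    d = N ∸ j
    F = strided N q j
    P = N P′ j
    rearrangeˡ : ∀ a c F → a * a * (c * F) ≡ c * (a * a * F)
    rearrangeˡ = solve-∀
    rearrangeʳ : ∀ c d P → c * (d * d * P) ≡ (c * d) * (d * P)
    rearrangeʳ = solve-∀

  stridedBound-extend : ∀ {N q j J} → 2 ≤ q → 2 ≤ j → j ≤′ J → q * J ≤ N →
                        StridedBound N q j → StridedBound N q J
  stridedBound-extend q≥2 j≥2 ≤′-refl qJ≤N bound = bound
  stridedBound-extend {q = q} {J = suc J} q≥2 j≥2 (≤′-step j≤′J) qJ≤N bound =
    stridedBound-suc q≥2 (≤-trans j≥2 (≤′⇒≤ j≤′J)) qJ<N
      (stridedBound-extend q≥2 j≥2 j≤′J (<⇒≤ qJ<N) bound)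
    where
    qJ<N = <-≤-trans (*-monoʳ-< q {{>-nonZero (≤-trans (s≤s z≤n) q≥2)}} (n<1+n J)) qJ≤N

  stridedBound-2 : ∀ t {q} → 3 ≤ q → StridedBound (3 + t) q 2
  stridedBound-2 t {q} q≥3 rewrite *-zeroʳ q = begin-strict
    (2 + t) * (2 + t) * ((N ∸ q * 1) * (N * 1))
      ≤⟨ *-monoʳ-≤ ((2 + t) * (2 + t)) (*-monoˡ-≤ (N * 1) (∸-monoʳ-≤ N q*1≥3)) ⟩
    (2 + t) * (2 + t) * (t * (N * 1))
      <⟨ m<m+n _ {(2 + t) * (N * 1)} (s≤s z≤n) ⟩
    (2 + t) * (2 + t) * (t * (N * 1)) + (2 + t) * (N * 1)
      ≡⟨ expand t ⟩
    (1 + t) * (1 + t) * ((2 + t) * (N * 1)) ∎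
    where
    open ≤-Reasoning
    N = 3 + t
    q*1≥3 : 3 ≤ q * 1
    q*1≥3 = ≤-trans q≥3 (≤-reflexive (sym (*-identityʳ q)))
    expand : ∀ t → (2 + t) * (2 + t) * (t * ((3 + t) * 1)) + (2 + t) * ((3 + t) * 1)
                 ≡ (1 + t) * (1 + t) * ((2 + t) * ((3 + t) * 1))
    expand = solve-∀

  stridedBound-4 : ∀ t → StridedBound (8 + t) 2 4
  stridedBound-4 t = begin-strict
    (7 + t) * (7 + t) * ((2 + t) * ((4 + t) * ((6 + t) * ((8 + t) * 1))))
      <⟨ m<m+n _ {6 * ((4 + t) * ((6 + t) * ((7 + t) * (8 + t))))} (s≤s z≤n) ⟩
    (7 + t) * (7 + t) * ((2 + t) * ((4 + t) * ((6 + t) * ((8 + t) * 1))))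
      + 6 * ((4 + t) * ((6 + t) * ((7 + t) * (8 + t))))
      ≡⟨ expand t ⟩
    (4 + t) * (4 + t) * ((5 + t) * ((6 + t) * ((7 + t) * ((8 + t) * 1)))) ∎
    where
    open ≤-Reasoning
    expand : ∀ t → (7 + t) * (7 + t) * ((2 + t) * ((4 + t) * ((6 + t) * ((8 + t) * 1))))
                     + 6 * ((4 + t) * ((6 + t) * ((7 + t) * (8 + t))))
                 ≡ (4 + t) * (4 + t) * ((5 + t) * ((6 + t) * ((7 + t) * ((8 + t) * 1))))
    expand = solve-∀

  stridedBound : ∀ {N q K} → (3 ≤ q × 3 ≤ K) ⊎ (q ≡ 2 × 4 ≤ K) → q * K ≤ N → StridedBound N q K
  stridedBound {q = q} {K} (inj₁ (q≥3 , K≥3)) qK≤N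
    with m≤n⇒∃[o]m+o≡n (≤-trans q≥3 (≤-trans (m≤m*n q K {{K≢0}}) qK≤N))
    where K≢0 = >-nonZero (≤-trans (s≤s z≤n) K≥3)
  ... | t , refl =
    stridedBound-extend (≤-trans (n≤1+n 2) q≥3) ≤-refl (≤⇒≤′ (≤-trans (n≤1+n 2) K≥3)) qK≤N
      (stridedBound-2 t q≥3)
  stridedBound (inj₂ (refl , K≥4)) qK≤N with m≤n⇒∃[o]m+o≡n (≤-trans (*-monoʳ-≤ 2 K≥4) qK≤N)
  ... | t , refl = stridedBound-extend ≤-refl (s≤s (s≤s z≤n)) (≤⇒≤′ K≥4) qK≤N (stridedBound-4 t)

  nP′k≡nCk*k! : ∀ {n k} → k ≤ n → n P′ k ≡ (n C k) * k !
  nP′k≡nCk*k! {n} {k} k≤n = sym (begin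
    (n C k) * k !             ≡⟨ cong (_* k !) (nCk≡nPk/k! k≤n) ⟩
    ((n P k) / k !) * k !     ≡⟨ cong (λ x → (x / k !) * k !) nPk≡nP′k ⟩
    ((n P′ k) / k !) * k !    ≡⟨ m/n*n≡m (k!∣nP′k k≤n) ⟩
    n P′ k                    ∎)
    where
    open ≡-Reasoning
    instance _ = k !≢0
    nPk≡nP′k : n P k ≡ n P′ k
    nPk≡nP′k with k ≤ᵇ n | ≤⇒≤ᵇ k≤n
    ... | true | _ = refl

  nP′k≢0 : ∀ {n k} → k ≤ n → NonZero (n P′ k)
  nP′k≢0 {k = zero}  _   = _
  nP′k≢0 {n} {suc k} k<n = m*n≢0 (n ∸ k) (n P′ k) {{>-nonZero (m<n⇒0<n∸m k<n)}} {{nP′k≢0 (<⇒≤ k<n)}}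

  nCk≢0 : ∀ {n k} → k ≤ n → NonZero (n C k)
  nCk≢0 {n} {k} k≤n = m*n≢0⇒m≢0 (n C k) {{subst NonZero (nP′k≡nCk*k! k≤n) (nP′k≢0 k≤n)}}

  strided-scaled : ∀ q M j → strided (q * M) q j ≡ q ^ j * (M P′ j)
  strided-scaled q M zero    = refl
  strided-scaled q M (suc j) = begin
    (q * M ∸ q * j) * strided (q * M) q j   ≡⟨ cong₂ _*_ (*-distribˡ-∸ q M j) (sym (strided-scaled q M j)) ⟨
    q * (M ∸ j) * (q ^ j * (M P′ j))        ≡⟨ interchange q (M ∸ j) (q ^ j) (M P′ j) ⟩
    q * q ^ j * ((M ∸ j) * (M P′ j))        ∎
    where
    open ≡-Reasoning
    interchange : ∀ a b c d → a * b * (c * d) ≡ a * c * (b * d)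
    interchange = solve-∀

  1+n≤2^n : ∀ n → 1 + n ≤ 2 ^ n
  1+n≤2^n zero    = ≤-refl
  1+n≤2^n (suc n) = begin
    2 + n               ≤⟨ +-monoʳ-≤ 1 (1+n≤2^n n) ⟩
    1 + 2 ^ n           ≤⟨ +-monoˡ-≤ (2 ^ n) (m^n>0 2 n) ⟩
    2 ^ n + 2 ^ n       ≡⟨ cong (2 ^ n +_) (+-identityʳ (2 ^ n)) ⟨
    2 * 2 ^ n           ∎
    where open ≤-Reasoning

  2*n≤q^n : ∀ {q} n → 2 ≤ q → 2 * n ≤ q ^ n
  2*n≤q^n zero    _   = z≤n
  2*n≤q^n (suc n) q≥2 = ≤-trans (*-monoʳ-≤ 2 (1+n≤2^n n)) (^-monoˡ-≤ (suc n) q≥2)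

  ^-split : ∀ q {m n} → n ≤ m → q ^ m ≡ q ^ (m ∸ n) * q ^ n
  ^-split q {m} {n} n≤m = trans (cong (q ^_) (sym (m∸n+n≡m n≤m))) (^-distribˡ-+-* q (m ∸ n) n)

  q^[2*k]≡[q^k]² : ∀ q k → q ^ (2 * k) ≡ q ^ k * q ^ k
  q^[2*k]≡[q^k]² q k = trans (^-distribˡ-+-* q k (k + 0)) (cong (λ e → q ^ k * q ^ e) (+-identityʳ k))

  binomial-of-powers-< : ∀ {q m k} → 2 ≤ q → k ≤ m → (3 ≤ q × 3 ≤ q ^ k) ⊎ (q ≡ 2 × 4 ≤ q ^ k) →
    (q ^ suc m ∸ 1) * (q ^ suc m ∸ 1) * q ^ (q ^ k ∸ 2 * k) * ((q ^ m) C (q ^ k))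
      < (q ^ (suc m ∸ k) ∸ 1) * (q ^ (suc m ∸ k) ∸ 1) * ((q ^ suc m) C (q ^ k))
  binomial-of-powers-< {q} {m} {k} q≥2 k≤m cases = *-cancelʳ-< (K * K * K !) _ _ (begin-strict
    a * a * Q * (M C K) * (K * K * K !)        ≡⟨ rearrangeˡ a Q K (M C K) (K !) ⟩
    a * a * ((Q * (K * K)) * ((M C K) * K !))  ≡⟨ cong₂ (λ u v → a * a * (u * v)) q^K≡Q*K² (nP′k≡nCk*k! K≤M) ⟨
    a * a * (q ^ K * (M P′ K))                 ≡⟨ cong (a * a *_) (strided-scaled q M K) ⟨
    a * a * strided N q K                      <⟨ stridedBound cases (^-monoʳ-≤ q (s≤s k≤m)) ⟩
    (N ∸ K) * (N ∸ K) * (N P′ K)               ≡⟨ cong₂ (λ u v → u * u * v) N∸K≡b*K (nP′k≡nCk*k! K≤N) ⟩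
    (b * K) * (b * K) * ((N C K) * K !)        ≡⟨ rearrangeʳ b K (N C K) (K !) ⟩
    b * b * (N C K) * (K * K * K !)            ∎)
    where
    open ≤-Reasoning
    instance _ = >-nonZero (≤-trans (s≤s z≤n) q≥2)
    M = q ^ m
    N = q ^ suc m
    K = q ^ k
    a = N ∸ 1
    b = q ^ (suc m ∸ k) ∸ 1
    Q = q ^ (K ∸ 2 * k)
    K≤M : K ≤ M
    K≤M = ^-monoʳ-≤ q k≤m
    K≤N : K ≤ N
    K≤N = ≤-trans K≤M (m≤n*m M q)
    q^K≡Q*K² : q ^ K ≡ Q * (K * K)
    q^K≡Q*K² = trans (^-split q (2*n≤q^n k q≥2)) (cong (Q *_) (q^[2*k]≡[q^k]² q k))
    N∸K≡b*K : N ∸ K ≡ b * K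
    N∸K≡b*K = begin-equality
      N ∸ K                           ≡⟨ cong (_∸ K) (^-split q (≤-trans k≤m (n≤1+n m))) ⟩
      q ^ (suc m ∸ k) * K ∸ K         ≡⟨ cong (q ^ (suc m ∸ k) * K ∸_) (*-identityˡ K) ⟨
      q ^ (suc m ∸ k) * K ∸ 1 * K     ≡⟨ *-distribʳ-∸ K (q ^ (suc m ∸ k)) 1 ⟨
      b * K                           ∎
    rearrangeˡ : ∀ a Q K C f → a * a * Q * C * (K * K * f) ≡ a * a * ((Q * (K * K)) * (C * f))
    rearrangeˡ = solve-∀
    rearrangeʳ : ∀ b K C f → (b * K) * (b * K) * (C * f) ≡ b * b * C * (K * K * f)
    rearrangeʳ = solve-∀

  q≤q^e : ∀ q {e} .{{_ : NonZero q}} → 1 ≤ e → q ≤ q ^ e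
  q≤q^e q e≥1 = ≤-trans (≤-reflexive (sym (*-identityʳ q))) (^-monoʳ-≤ q e≥1)

  q^e∸1≢0 : ∀ {q e} → 2 ≤ q → 1 ≤ e → NonZero (q ^ e ∸ 1)
  q^e∸1≢0 {q} q≥2 e≥1 = >-nonZero (m<n⇒0<n∸m (≤-trans q≥2 (q≤q^e q {{q≢0}} e≥1)))
    where q≢0 = >-nonZero (≤-trans (s≤s z≤n) q≥2)

  hypothesis-cases : ∀ {q m k} → (2 < q × 1 ≤ k × k < suc m) ⊎ (q ≡ 2 × 2 ≤ k × k < suc m) →
    2 ≤ q × k ≤ m × ((3 ≤ q × 3 ≤ q ^ k) ⊎ (q ≡ 2 × 4 ≤ q ^ k))
  hypothesis-cases {q} (inj₁ (q>2 , k≥1 , s≤s k≤m)) =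
    <⇒≤ q>2 , k≤m , inj₁ (q>2 , ≤-trans q>2 (q≤q^e q {{q≢0}} k≥1))
    where q≢0 = >-nonZero (≤-trans (s≤s z≤n) q>2)
  hypothesis-cases (inj₂ (refl , k≥2 , s≤s k≤m)) = s≤s (s≤s z≤n) , k≤m , inj₂ (refl , ^-monoʳ-≤ 2 k≥2)

module _ where

  open import Data.Nat as ℕ using (ℕ; zero; suc; NonZero)
  import Data.Nat.Properties as ℕ
  open import Data.Nat.Tactic.RingSolver using (solve-∀)
  open import Data.Integer as ℤ using (+_)
  import Data.Integer.Properties as ℤ
  open import Data.Rational as ℚ using (ℚ; _*_; 1ℚ; _<_; Positive; toℚᵘ)
  open import Data.Rational.Properties
  import Data.Rational.Unnormalised as ℚᵘ
  import Data.Rational.Unnormalised.Properties as ℚᵘ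
  open import Data.Rational.Solver using (module +-*-Solver)
  open import Relation.Binary.PropositionalEquality

  ⟦_⟧ : ℕ → ℚ
  ⟦ a ⟧ = a ÷ℕ 1

  toℚᵘ-÷ℕ : ∀ a b → toℚᵘ (a ÷ℕ suc b) ℚᵘ.≃ ℚᵘ.mkℚᵘ (+ a) b
  toℚᵘ-÷ℕ a b = toℚᵘ-fromℚᵘ (ℚᵘ.mkℚᵘ (+ a) b)

  ÷ℕ-cross : ∀ {a b c d} → a ℕ.* suc d ≡ c ℕ.* suc b → a ÷ℕ suc b ≡ c ÷ℕ suc d
  ÷ℕ-cross {a} {b} {c} {d} ad≡cb = toℚᵘ-injective (ℚᵘ.≃-trans (toℚᵘ-÷ℕ a b)
    (ℚᵘ.≃-trans (ℚᵘ.*≡* cross) (ℚᵘ.≃-sym (toℚᵘ-÷ℕ c d))))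
    where
    cross : + a ℤ.* + suc d ≡ + c ℤ.* + suc b
    cross = trans (sym (ℤ.pos-* a (suc d))) (trans (cong +_ ad≡cb) (ℤ.pos-* c (suc b)))

  ÷ℕ-* : ∀ a b c d → (a ÷ℕ suc b) * (c ÷ℕ suc d) ≡ (a ℕ.* c) ÷ℕ (suc b ℕ.* suc d)
  ÷ℕ-* a b c d = toℚᵘ-injective (ℚᵘ.≃-trans (toℚᵘ-homo-* (a ÷ℕ suc b) (c ÷ℕ suc d))
    (ℚᵘ.≃-trans (ℚᵘ.*-cong (toℚᵘ-÷ℕ a b) (toℚᵘ-÷ℕ c d))
    (ℚᵘ.≃-trans (ℚᵘ.≃-reflexive (cong (λ i → ℚᵘ.mkℚᵘ i _) (sym (ℤ.pos-* a c))))
    (ℚᵘ.≃-sym (toℚᵘ-÷ℕ (a ℕ.* c) _)))))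

  ⟦⟧-* : ∀ a b → ⟦ a ⟧ * ⟦ b ⟧ ≡ ⟦ a ℕ.* b ⟧
  ⟦⟧-* a b = ÷ℕ-* a 0 b 0

  ÷ℕ≡*1÷ℕ : ∀ a d → a ÷ℕ d ≡ ⟦ a ⟧ * (1 ÷ℕ d)
  ÷ℕ≡*1÷ℕ a zero    = sym (*-zeroʳ ⟦ a ⟧)
  ÷ℕ≡*1÷ℕ a (suc d) = sym (trans (÷ℕ-* a 0 1 d) (÷ℕ-cross {a ℕ.* 1} {_} {a} {d} (reassoc a d)))
    where
    reassoc : ∀ a d → a ℕ.* 1 ℕ.* suc d ≡ a ℕ.* (1 ℕ.* suc d)
    reassoc = solve-∀

  1÷ℕ-inverseˡ : ∀ c .{{_ : NonZero c}} → (1 ÷ℕ c) * ⟦ c ⟧ ≡ 1ℚ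
  1÷ℕ-inverseˡ (suc c) = trans (÷ℕ-* 1 c (suc c) 0) (÷ℕ-cross {1 ℕ.* suc c} {c ℕ.* 1} {1} {0} (reassoc c))
    where
    reassoc : ∀ c → 1 ℕ.* suc c ℕ.* 1 ≡ 1 ℕ.* (suc c ℕ.* 1)
    reassoc = solve-∀

  ⟦⟧-*₃ : ∀ a b c → ⟦ a ℕ.* b ℕ.* c ⟧ ≡ ⟦ a ⟧ * ⟦ b ⟧ * ⟦ c ⟧
  ⟦⟧-*₃ a b c = trans (sym (⟦⟧-* (a ℕ.* b) c)) (cong (_* ⟦ c ⟧) (sym (⟦⟧-* a b)))

  ⟦⟧-*₄ : ∀ a b c d → ⟦ a ℕ.* b ℕ.* c ℕ.* d ⟧ ≡ ⟦ a ⟧ * ⟦ b ⟧ * ⟦ c ⟧ * ⟦ d ⟧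
  ⟦⟧-*₄ a b c d = trans (sym (⟦⟧-* (a ℕ.* b ℕ.* c) d)) (cong (_* ⟦ d ⟧) (⟦⟧-*₃ a b c))

  ⟦⟧-mono-< : ∀ {a b} → a ℕ.< b → ⟦ a ⟧ < ⟦ b ⟧
  ⟦⟧-mono-< {a} {b} a<b = toℚᵘ-cancel-< (ℚᵘ.<-respˡ-≃ (ℚᵘ.≃-sym (toℚᵘ-÷ℕ a 0))
    (ℚᵘ.<-respʳ-≃ (ℚᵘ.≃-sym (toℚᵘ-÷ℕ b 0)) (ℚᵘ.*<* cross)))
    where
    cross : + a ℤ.* + 1 ℤ.< + b ℤ.* + 1
    cross = subst₂ ℤ._<_ (sym (ℤ.*-identityʳ (+ a))) (sym (ℤ.*-identityʳ (+ b))) (ℤ.+<+ a<b)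

  ⟦⟧-pos : ∀ a .{{_ : NonZero a}} → Positive ⟦ a ⟧
  ⟦⟧-pos (suc a) = normalize-pos (suc a) 1

  ÷ℕ-pos : ∀ a b .{{_ : NonZero a}} .{{_ : NonZero b}} → Positive (a ÷ℕ b)
  ÷ℕ-pos (suc a) (suc b) = normalize-pos (suc a) (suc b)

  gaussProd-shift : ∀ q m k i →
    gaussProd q (suc m) k i * ⟦ q ℕ.^ (suc m ℕ.∸ i) ℕ.∸ 1 ⟧ ≡ gaussProd q m k i * ⟦ q ℕ.^ suc m ℕ.∸ 1 ⟧
  gaussProd-shift q m k zero    = refl
  gaussProd-shift q m k (suc i) = begin
    G′ * ((q ℕ.^ (suc m ℕ.∸ i) ℕ.∸ 1) ÷ℕ d) * b  ≡⟨ cong (λ u → G′ * u * b) (÷ℕ≡*1÷ℕ _ d) ⟩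
    G′ * (a * d⁻¹) * b                            ≡⟨ reassoc G′ a d⁻¹ b ⟩
    G′ * a * d⁻¹ * b                              ≡⟨ cong (λ u → u * d⁻¹ * b) (gaussProd-shift q m k i) ⟩
    G * c * d⁻¹ * b                               ≡⟨ exchange G c d⁻¹ b ⟩
    G * (b * d⁻¹) * c                             ≡⟨ cong (λ u → G * u * c) (÷ℕ≡*1÷ℕ _ d) ⟨
    G * ((q ℕ.^ (m ℕ.∸ i) ℕ.∸ 1) ÷ℕ d) * c        ∎
    where
    open ≡-Reasoning
    open +-*-Solver using (solve; _:=_; _:*_)
    d = q ℕ.^ (k ℕ.∸ i) ℕ.∸ 1
    G′ = gaussProd q (suc m) k i
    G = gaussProd q m k i
    a = ⟦ q ℕ.^ (suc m ℕ.∸ i) ℕ.∸ 1 ⟧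
    b = ⟦ q ℕ.^ (m ℕ.∸ i) ℕ.∸ 1 ⟧
    c = ⟦ q ℕ.^ suc m ℕ.∸ 1 ⟧
    d⁻¹ = 1 ÷ℕ d
    reassoc : ∀ x y z w → x * (y * z) * w ≡ x * y * z * w
    reassoc = solve 4 (λ x y z w → x :* (y :* z) :* w := x :* y :* z :* w) refl
    exchange : ∀ x y z w → x * y * z * w ≡ x * (w * z) * y
    exchange = solve 4 (λ x y z w → x :* y :* z :* w := x :* (w :* z) :* y) refl

  gaussProd-pos : ∀ {q m k i} → 2 ℕ.≤ q → i ℕ.≤ k → k ℕ.≤ m → Positive (gaussProd q m k i)
  gaussProd-pos {i = zero}  _   _   _   = normalize-pos 1 1
  gaussProd-pos {q} {m} {k} {suc i} q≥2 i<k k≤m =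
    pos*pos⇒pos (gaussProd q m k i) {{gaussProd-pos q≥2 (ℕ.<⇒≤ i<k) k≤m}} _
      {{÷ℕ-pos _ _ {{q^e∸1≢0 q≥2 (ℕ.m<n⇒0<n∸m (ℕ.<-≤-trans i<k k≤m))}}
                   {{q^e∸1≢0 q≥2 (ℕ.m<n⇒0<n∸m i<k)}}}}

  cross-multiply-< : ∀ {G g A B X X′ Y C C′ Q} → G * B ≡ g * A →
    X * C ≡ 1ℚ → X′ * C′ ≡ 1ℚ → Y * Q ≡ 1ℚ →
    .{{_ : Positive B}} → .{{_ : Positive C}} → .{{_ : Positive C′}} → .{{_ : Positive Q}} →
    .{{_ : Positive g}} →
    A * A * Q * C′ < B * B * C → G * G * X < Y * (g * g * X′)
  cross-multiply-< {G} {g} {A} {B} {X} {X′} {Y} {C} {C′} {Q} GB≡gA XC≡1 X′C′≡1 YQ≡1 A²QC′<B²C =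
    *-cancelʳ-<-nonNeg P {{pos⇒nonNeg P}} (begin-strict
      G * G * X * P                          ≡⟨ scaleˡ ⟩
      g * g * (A * A * Q * C′)               <⟨ *-monoʳ-<-pos (g * g) {{pos*pos⇒pos g g}} A²QC′<B²C ⟩
      g * g * (B * B * C)                    ≡⟨ scaleʳ ⟨
      Y * (g * g * X′) * P                   ∎)
    where
    open ≤-Reasoning
    open +-*-Solver using (solve; _:=_; _:*_; con)
    P = B * B * C * C′ * Q
    instance
      _ : Positive P
      _ = pos*pos⇒pos (B * B * C * C′)
            {{pos*pos⇒pos (B * B * C) {{pos*pos⇒pos (B * B) {{pos*pos⇒pos B B}} C}} C′}} Q
    regroupˡ : ∀ G B X C C′ Q → G * G * X * (B * B * C * C′ * Q) ≡ G * B * (G * B) * (X * C) * C′ * Q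
    regroupˡ = solve 6 (λ G B X C C′ Q → G :* G :* X :* (B :* B :* C :* C′ :* Q)
                                     := G :* B :* (G :* B) :* (X :* C) :* C′ :* Q) refl
    regroupʳ : ∀ Y g X′ B C C′ Q → Y * (g * g * X′) * (B * B * C * C′ * Q)
                                 ≡ Y * Q * (X′ * C′) * (g * g * (B * B * C))
    regroupʳ = solve 7 (λ Y g X′ B C C′ Q → Y :* (g :* g :* X′) :* (B :* B :* C :* C′ :* Q)
                                         := Y :* Q :* (X′ :* C′) :* (g :* g :* (B :* B :* C))) refl
    collect : ∀ g A C′ Q → g * A * (g * A) * 1ℚ * C′ * Q ≡ g * g * (A * A * Q * C′)
    collect = solve 4 (λ g A C′ Q → g :* A :* (g :* A) :* con 1ℚ :* C′ :* Q
                                 := g :* g :* (A :* A :* Q :* C′)) refl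
    scaleˡ : G * G * X * P ≡ g * g * (A * A * Q * C′)
    scaleˡ = begin-equality
      G * G * X * P                         ≡⟨ regroupˡ G B X C C′ Q ⟩
      G * B * (G * B) * (X * C) * C′ * Q    ≡⟨ cong₂ (λ u v → u * u * v * C′ * Q) GB≡gA XC≡1 ⟩
      g * A * (g * A) * 1ℚ * C′ * Q         ≡⟨ collect g A C′ Q ⟩
      g * g * (A * A * Q * C′)              ∎
    scaleʳ : Y * (g * g * X′) * P ≡ g * g * (B * B * C)
    scaleʳ = begin-equality
      Y * (g * g * X′) * P                  ≡⟨ regroupʳ Y g X′ B C C′ Q ⟩
      Y * Q * (X′ * C′) * (g * g * (B * B * C))
                                            ≡⟨ cong₂ (λ u v → u * v * (g * g * (B * B * C))) YQ≡1 X′C′≡1 ⟩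
      1ℚ * 1ℚ * (g * g * (B * B * C))       ≡⟨ solve 1 (λ x → con 1ℚ :* con 1ℚ :* x := x) refl _ ⟩
      g * g * (B * B * C)                   ∎

  ratio-< : ∀ G g A B c c′ r .{{_ : NonZero B}} .{{_ : NonZero c}} .{{_ : NonZero c′}} .{{_ : NonZero r}}
            .{{_ : Positive g}} → G * ⟦ B ⟧ ≡ g * ⟦ A ⟧ → A ℕ.* A ℕ.* r ℕ.* c′ ℕ.< B ℕ.* B ℕ.* c →
            G * G * (1 ÷ℕ c) < (1 ÷ℕ r) * (g * g * (1 ÷ℕ c′))
  ratio-< G g A B c c′ r GB≡gA A²rc′<B²c =
    cross-multiply-< {G} {g} {⟦ A ⟧} {⟦ B ⟧} {1 ÷ℕ c} {1 ÷ℕ c′} {1 ÷ℕ r} {⟦ c ⟧} {⟦ c′ ⟧} {⟦ r ⟧}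
      GB≡gA (1÷ℕ-inverseˡ c) (1÷ℕ-inverseˡ c′) (1÷ℕ-inverseˡ r)
      {{⟦⟧-pos B}} {{⟦⟧-pos c}} {{⟦⟧-pos c′}} {{⟦⟧-pos r}}
      (subst₂ _<_ (⟦⟧-*₄ A A r c′) (⟦⟧-*₃ B B c) (⟦⟧-mono-< A²rc′<B²c))

open import Data.Nat as ℕ using (ℕ; _∸_; _^_; _≤_; _<_)
open import Data.Nat.Combinatorics using (_C_)
open import Data.Sum using (_⊎_; inj₁; inj₂)
open import Data.Product using (_×_; _,_)
open import Relation.Binary.PropositionalEquality using (_≡_)
open import Data.Rational as ℚ using (_*_)
import Data.Nat.Properties as ℕ

lemma3p1 : (q n k : ℕ) →
    ((2 < q × 1 ≤ k × k < n) ⊎ (q ≡ 2 × 2 ≤ k × k < n)) →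
    (gaussBinom q n k * gaussBinom q n k) * (1 ÷ℕ ((q ^ n) C (q ^ k)))
      ℚ.< (1 ÷ℕ (q ^ (q ^ k ∸ 2 ℕ.* k)))
          * ((gaussBinom q (n ∸ 1) k * gaussBinom q (n ∸ 1) k)
             * (1 ÷ℕ ((q ^ (n ∸ 1)) C (q ^ k))))
lemma3p1 q ℕ.zero k (inj₁ (_ , _ , ()))
lemma3p1 q ℕ.zero k (inj₂ (_ , _ , ()))
lemma3p1 q (ℕ.suc m) k hyp with hypothesis-cases hyp
... | q≥2 , k≤m , cases =
  ratio-< (gaussBinom q (ℕ.suc m) k) (gaussBinom q m k)
          (q ^ ℕ.suc m ∸ 1) (q ^ (ℕ.suc m ∸ k) ∸ 1)
          ((q ^ ℕ.suc m) C (q ^ k)) ((q ^ m) C (q ^ k)) (q ^ (q ^ k ∸ 2 ℕ.* k))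
    (gaussProd-shift q m k k) (binomial-of-powers-< q≥2 k≤m cases)
  where
  instance
    q≢0 = ℕ.>-nonZero (ℕ.≤-trans (ℕ.s≤s ℕ.z≤n) q≥2)
    q^[m+1-k]∸1≢0 = q^e∸1≢0 q≥2 (ℕ.m<n⇒0<n∸m (ℕ.s≤s k≤m))
    q^[q^k∸2k]≢0 = ℕ.m^n≢0 q (q ^ k ∸ 2 ℕ.* k)
    Cₙ≢0 = nCk≢0 (ℕ.^-monoʳ-≤ q (ℕ.m≤n⇒m≤1+n k≤m))
    Cₘ≢0 = nCk≢0 (ℕ.^-monoʳ-≤ q k≤m)
    gaussBinom-pos = gaussProd-pos q≥2 ℕ.≤-refl k≤m
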